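{- For every sufficiently small $\varepsilon>0$ there is $n_0$ such that for all $n\geq n_0$: if $G$ is an $\varepsilon$-superextremal two-clique on $n$ vertices with partition $V(G)=A\uplus B$ and $f,f'$ are two vertex-disjoint edges of $G$ each with one endpoint in $A$ and one in $B$, then $G$ has a Hamilton cycle which contains $f$ and $f'$.
   Context: For $v\in V(G)$ and $S\subseteq V(G)$, $d_G(v,S)$ is the number of neighbours of $v$ in $S$. A graph $G$ on $n$ vertices is an $\varepsilon$-superextremal two-clique with partition $V(G)=A\uplus B$ if: (A1) $||A|-|B||\leq\varepsilon n$; (A2) $d_G(a,A)\geq(1/2-\varepsilon)n$ for all but at most $\varepsilon n$ vertices $a\in A$; (A3) $d_G(a,A)\geq(1/4-\varepsilon)n$ for all $a\in A$; (A4) $d_G(b,B)\geq(1/2-\varepsilon)n$ for all but at most $\varepsilon n$ vertices $b\in B$; (A5) $d_G(b,B)\geq(1/4-\varepsilon)n$ for all $b\in B$.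
   Formalization: The parameter ε ranges over the positive rationals, both in the quantifier over sufficiently small ε and in the definition of an ε-superextremal two-clique. -}

module Defs where

open import Data.Nat as ℕ using (ℕ; zero; suc; _<?_; s≤s)
open import Data.Fin using (Fin; zero; suc; toℕ; fromℕ<)
open import Data.Bool using (Bool; true; false; _∧_; if_then_else_)
open import Data.List using (List; length; filter; allFin)
open import Data.Integer using (+_)
open import Data.Rational using (ℚ; _/_; _*_; _-_; ∣_∣; _≤_; _<_; ½; 0ℚ)
open import Data.Product using (Σ; _×_; _,_; ∃)
open import Relation.Binary.PropositionalEquality using (_≡_; _≢_)
open import Relation.Nullary.Decidable using (yes; no)
open import Data.Fin.Permutation using (Permutation′; _⟨$⟩ʳ_)
open import Data.Sum using (_⊎_)

⟦_⟧ : ℕ → ℚ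
⟦ n ⟧ = + n / 1

¼ : ℚ
¼ = + 1 / 4

record Graph (n : ℕ) : Set where
  field
    adj   : Fin n → Fin n → Bool
    sym   : ∀ u v → adj u v ≡ adj v u
    irrefl : ∀ v → adj v v ≡ false
open Graph public

Subset : ℕ → Set
Subset n = Fin n → Bool

∣_∣ₛ : ∀ {n} → Subset n → ℕ
∣_∣ₛ {n} S = length (filter (λ v → S v Data.Bool.≟ true) (allFin n))

∁ : ∀ {n} → Subset n → Subset n
∁ S v = if S v then false else true

deg : ∀ {n} → Graph n → Fin n → Subset n → ℕ
deg G v S = ∣ (λ w → adj G v w ∧ S w) ∣ₛ

AllButFew : ∀ {n} → Graph n → Subset n → ℚ → Set
AllButFew {n} G X ε =
  Σ (Subset n) λ E →
    (∀ v → E v ≡ true → X v ≡ true) ×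
    (⟦ ∣ E ∣ₛ ⟧ ≤ ε * ⟦ n ⟧) ×
    (∀ v → X v ≡ true → E v ≡ false → (½ - ε) * ⟦ n ⟧ ≤ ⟦ deg G v X ⟧)

SuperExtremal : ∀ {n} → ℚ → Graph n → Subset n → Set
SuperExtremal {n} ε G A =
  (∣ ⟦ ∣ A ∣ₛ ⟧ - ⟦ ∣ B ∣ₛ ⟧ ∣ ≤ ε * ⟦ n ⟧) ×                                   -- (A1)
  AllButFew G A ε ×                                                           -- (A2)
  (∀ a → A a ≡ true → (¼ - ε) * ⟦ n ⟧ ≤ ⟦ deg G a A ⟧) ×                      -- (A3)
  AllButFew G B ε ×                                                           -- (A4)
  (∀ b → B b ≡ true → (¼ - ε) * ⟦ n ⟧ ≤ ⟦ deg G b B ⟧)                        -- (A5)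
  where B = ∁ A

next : ∀ {n} → Fin n → Fin n
next {suc m} i with suc (toℕ i) <? suc m
... | yes p = fromℕ< p
... | no _  = zero

IsHamCycle : ∀ {n} → Graph n → Permutation′ n → Set
IsHamCycle {n} G σ = ∀ i → adj G (σ ⟨$⟩ʳ i) (σ ⟨$⟩ʳ next i) ≡ true

UsesEdge : ∀ {n} → Permutation′ n → Fin n → Fin n → Set
UsesEdge σ u v = ∃ λ i →
  ((σ ⟨$⟩ʳ i ≡ u) × (σ ⟨$⟩ʳ next i ≡ v)) ⊎ ((σ ⟨$⟩ʳ i ≡ v) × (σ ⟨$⟩ʳ next i ≡ u))

module Submission where

-- For ε ≤ 1/1000 and n ≥ 21, (A2)–(A5) give each side X a set E of at most n/1000
-- exceptional vertices; the others have ≥ 0.499n neighbours in X and all have ≥ 0.249n.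
-- A good vertex of the other side Y shows |Y| ≥ 0.499n, so |X| ≤ 0.501n and every good
-- vertex of X misses at most s = n/500 vertices of X.  Module HamiltonPathInDenseSet
-- then builds a Hamilton path of X between any two vertices y ≠ x: starting at x, each
-- exceptional vertex is absorbed through two fresh good vertices, 2s + 1 good vertices
-- are appended, and the path is closed at y; the large minimum degree always leaves a
-- fresh choice.  A remaining vertex v is good and misses at most s of the > 2s + 1 path
-- vertices, so it has two consecutive neighbours on the path and is inserted between
-- them.  The paths of A from a₂ to a₁ and of B from b₁ to b₂, with the edges a₁b₁ and
-- b₂a₂, form the cycle.

open import Defs renaming (sym to adj-sym)
open import Axiom.UniquenessOfIdentityProofs using (module Decidable⇒UIP)
open import Data.Bool using (Bool; true; false; _∧_; _∨_; not)
import Data.Bool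
import Data.Bool.Properties as Bool
open import Data.Empty using (⊥; ⊥-elim)
open import Data.Fin using (Fin; zero; suc; toℕ; fromℕ; cast)
import Data.Fin as Fin
open import Data.Fin.Permutation using (Permutation′; permutation)
open import Data.Fin.Properties using (toℕ-cast; cast-involutive; toℕ-injective; toℕ-fromℕ; toℕ<n; toℕ-fromℕ<)
open import Data.List using (List; []; _∷_; length; last; lookup; filter; _++_; allFin)
open import Data.List.Membership.Propositional using (_∈_; _∉_; find)
open import Data.List.Membership.Propositional.Properties using (∈-filter⁺; ∈-filter⁻; ∈-lookup; ∈-allFin; ∈-++⁺ˡ; ∈-++⁺ʳ)
open import Data.List.Membership.Setoid.Properties using (unique⇒irrelevant)
open import Data.List.Properties using (length-tabulate)
open import Data.List.Relation.Binary.Subset.Propositional using (_⊆_)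
import Data.List.Relation.Binary.Permutation.Propositional as ↭
open ↭ using (_↭_; ↭⇒↭ₛ)
open import Data.List.Relation.Binary.Permutation.Propositional.Properties using (∈-resp-↭; All-resp-↭)
open import Data.List.Relation.Unary.All as All using (All; []; _∷_; all?)
open import Data.List.Relation.Unary.All.Properties using (¬All⇒Any¬; ¬Any⇒All¬)
open import Data.List.Relation.Unary.AllPairs using ([]; _∷_)
open import Data.List.Relation.Unary.Any using (here; there; index; toSum)
open import Data.List.Relation.Unary.Any.Properties using (lookup-index)
open import Data.List.Relation.Unary.Linked using (Linked; [-]; _∷_)
open import Data.List.Relation.Unary.Linked.Properties as Linked using ()
open import Data.List.Relation.Unary.Unique.Propositional using (Unique)
import Data.List.Relation.Unary.Unique.Propositional.Properties as Unique
open import Data.Maybe using (just)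
open import Data.Maybe.Properties using (just-injective)
open import Data.Maybe.Relation.Binary.Connected using (Connected; just)
open import Data.Nat as ℕ using (ℕ; zero; suc; _+_; _*_; _≤_; _<_; _≥_; z≤n; s≤s)
open import Data.Nat.DivMod using (_/_; m*n/n≡m; /-monoˡ-≤; m/n*n≤m)
open import Data.Nat.Properties
open import Data.Nat.Tactic.RingSolver using (solve-∀)
open import Data.Product using (Σ; ∃; ∃₂; _×_; _,_; proj₁; proj₂)
open import Data.Rational as ℚ using (ℚ; 0ℚ)
open import Data.Sum using (_⊎_; inj₁; inj₂; [_,_]′)
open import Relation.Binary.Definitions using (DecidableEquality)
open import Relation.Binary.PropositionalEquality as ≡ using (_≡_; _≢_; refl; sym; trans; cong; subst; module ≡-Reasoning)
open import Relation.Nullary using (¬_; Dec; yes; no)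

∧-true : ∀ {a b} → a ∧ b ≡ true → a ≡ true × b ≡ true
∧-true {true} e = refl , e

∧-intro : ∀ {a b} → a ≡ true → b ≡ true → a ∧ b ≡ true
∧-intro refl refl = refl

not-true : ∀ {b} → not b ≡ true → b ≡ false
not-true {false} _ = refl

true-or-false : ∀ b → b ≡ true ⊎ b ≡ false
true-or-false true  = inj₁ refl
true-or-false false = inj₂ refl

true≢false : true ≢ false
true≢false ()

module _ {A : Set} where

  count : (A → Bool) → List A → ℕ
  count P xs = length (filter (λ v → P v Data.Bool.≟ true) xs)

  count-mono : ∀ {P Q : A → Bool} → (∀ v → P v ≡ true → Q v ≡ true) → ∀ xs → count P xs ≤ count Q xs
  count-mono h [] = z≤n
  count-mono {P} {Q} h (x ∷ xs) with P x in p | Q x in q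
  ... | true  | true  = s≤s (count-mono h xs)
  ... | true  | false with () ← trans (sym (h x p)) q
  ... | false | true  = m≤n⇒m≤1+n (count-mono h xs)
  ... | false | false = count-mono h xs

  count-cong : ∀ {P Q : A → Bool} → (∀ v → P v ≡ Q v) → ∀ xs → count P xs ≡ count Q xs
  count-cong h xs = ≤-antisym (count-mono (λ v e → trans (sym (h v)) e) xs)
                              (count-mono (λ v e → trans (h v) e) xs)

  count-∨ : ∀ (P Q : A → Bool) xs → count (λ v → P v ∨ Q v) xs ≤ count P xs + count Q xs
  count-∨ P Q [] = z≤n
  count-∨ P Q (x ∷ xs) with P x | Q x
  ... | true  | true  = s≤s (≤-trans (count-∨ P Q xs) (+-monoʳ-≤ (count P xs) (n≤1+n _)))
  ... | true  | false = s≤s (count-∨ P Q xs)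
  ... | false | true  = ≤-trans (s≤s (count-∨ P Q xs)) (≤-reflexive (sym (+-suc _ _)))
  ... | false | false = count-∨ P Q xs

  count-split : ∀ (P Q : A → Bool) xs →
                count P xs ≡ count (λ v → P v ∧ Q v) xs + count (λ v → P v ∧ not (Q v)) xs
  count-split P Q [] = refl
  count-split P Q (x ∷ xs) with P x | Q x
  ... | true  | true  = cong suc (count-split P Q xs)
  ... | true  | false = trans (cong suc (count-split P Q xs)) (sym (+-suc _ _))
  ... | false | _     = count-split P Q xs

  count-true : ∀ xs → count (λ _ → true) xs ≡ length xs
  count-true [] = refl
  count-true (x ∷ xs) = cong suc (count-true xs)

  remove : ∀ {x : A} ys → x ∈ ys → List A
  remove (y ∷ ys) (here _) = ys
  remove (y ∷ ys) (there p) = y ∷ remove ys p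

  length-remove : ∀ {x : A} ys (p : x ∈ ys) → length ys ≡ suc (length (remove ys p))
  length-remove (y ∷ ys) (here _) = refl
  length-remove (y ∷ ys) (there p) = cong suc (length-remove ys p)

  ∈-remove : ∀ {x y : A} ys (p : x ∈ ys) → y ∈ ys → y ≢ x → y ∈ remove ys p
  ∈-remove (z ∷ ys) (here refl) (here refl) y≢x = ⊥-elim (y≢x refl)
  ∈-remove (z ∷ ys) (here refl) (there q)   y≢x = q
  ∈-remove (z ∷ ys) (there p)   (here refl) y≢x = here refl
  ∈-remove (z ∷ ys) (there p)   (there q)   y≢x = there (∈-remove ys p q y≢x)

  pigeonhole : ∀ {xs ys : List A} → Unique xs → xs ⊆ ys → length xs ≤ length ys
  pigeonhole {[]} u sub = z≤n
  pigeonhole {x ∷ xs} {ys} (x∉xs ∷ u) sub =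
    ≤-trans (s≤s (pigeonhole u sub′)) (≤-reflexive (sym (length-remove ys (sub (here refl)))))
    where
    sub′ : xs ⊆ remove ys (sub (here refl))
    sub′ q = ∈-remove ys (sub (here refl)) (sub (there q)) (λ e → All.lookup x∉xs q (sym e))

  count-≤ : ∀ {P Q : A → Bool} {xs ys} → Unique xs →
            (∀ {v} → v ∈ xs → P v ≡ true → v ∈ ys × Q v ≡ true) → count P xs ≤ count Q ys
  count-≤ {P} {Q} {xs} {ys} u h = pigeonhole (Unique.filter⁺ _ u) sub
    where
    sub : filter (λ v → P v Data.Bool.≟ true) xs ⊆ filter (λ v → Q v Data.Bool.≟ true) ys
    sub p with ∈-filter⁻ (λ v → P v Data.Bool.≟ true) {xs = xs} p
    ... | v∈xs , Pv with h v∈xs Pv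
    ... | v∈ys , Qv = ∈-filter⁺ (λ v → Q v Data.Bool.≟ true) v∈ys Qv

  module _ (_≟_ : DecidableEquality A) where
    open import Data.List.Membership.DecPropositional _≟_ using (_∈?_)

    pick : ∀ (P : A → Bool) {xs} excl → Unique xs → length excl < count P xs →
           ∃ λ v → v ∈ xs × P v ≡ true × v ∉ excl
    pick P {xs} excl u lt with all? (_∈? excl) (filter (λ v → P v Data.Bool.≟ true) xs)
    ... | yes all∈ = ⊥-elim (<⇒≱ lt (pigeonhole (Unique.filter⁺ _ u) (All.lookup all∈)))
    ... | no ¬all∈ with find (¬All⇒Any¬ (_∈? excl) _ ¬all∈)
    ... | v , v∈ , v∉ with ∈-filter⁻ (λ v → P v Data.Bool.≟ true) {xs = xs} v∈
    ... | v∈xs , Pv = v , v∈xs , Pv , v∉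

Edge : ∀ {n} → Graph n → Fin n → Fin n → Set
Edge G u v = adj G u v ≡ true

module Insertion {n} (G : Graph n) where

  nonNbrsOn : Fin n → List (Fin n) → ℕ
  nonNbrsOn w = count (λ v → not (adj G w v))

  nonNbrsOn-∷-false : ∀ w c rest → adj G w c ≡ false → nonNbrsOn w (c ∷ rest) ≡ suc (nonNbrsOn w rest)
  nonNbrsOn-∷-false w c rest e rewrite e = refl

  nonNbrsOn-∷-true : ∀ w c rest → adj G w c ≡ true → nonNbrsOn w (c ∷ rest) ≡ nonNbrsOn w rest
  nonNbrsOn-∷-true w c rest e rewrite e = refl

  -- w inserted into the path c ∷ rest strictly after c, keeping both ends.
  Inserted : Fin n → Fin n → List (Fin n) → Set
  Inserted w c rest = ∃ λ rest′ → (w ∷ rest ↭ rest′) × Linked (Edge G) (c ∷ rest′) × last (c ∷ rest′) ≡ last (c ∷ rest)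

  -- Insertion is impossible: then at least half of the entries are non-neighbours of w.
  -- The second component, sharper when w is not adjacent to c, drives the induction.
  NoRoom : Fin n → Fin n → List (Fin n) → Set
  NoRoom w c rest = length (c ∷ rest) ≤ suc (2 * nonNbrsOn w (c ∷ rest)) ×
                    (adj G w c ≡ false → length (c ∷ rest) ≤ 2 * nonNbrsOn w (c ∷ rest))

  skip : ∀ {w c d r} → Edge G c d → Inserted w d r → Inserted w c (d ∷ r)
  skip {w} {d = d} cd (r′ , w∷r↭r′ , linked′ , ends) =
    d ∷ r′ , ↭.trans (↭.swap w d ↭.refl) (↭.prep d w∷r↭r′) , cd ∷ linked′ , ends

  insert : ∀ w c rest → Linked (Edge G) (c ∷ rest) → Inserted w c rest ⊎ NoRoom w c rest
  insert w c [] _ with adj G w c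
  ... | true  = inj₂ (s≤s z≤n , λ ())
  ... | false = inj₂ (s≤s z≤n , λ _ → s≤s z≤n)
  insert w c (d ∷ r) (cd ∷ linked) with insert w d r linked
  ... | inj₁ later = inj₁ (skip cd later)
  ... | inj₂ noRoom with true-or-false (adj G w c) | true-or-false (adj G w d)
  ...   | inj₁ wc | inj₁ wd = inj₁ (w ∷ d ∷ r , ↭.refl , trans (adj-sym G c w) wc ∷ wd ∷ linked , refl)
  ...   | inj₁ wc | inj₂ wd =
    inj₂ (subst (λ k → length (c ∷ d ∷ r) ≤ suc (2 * k)) (sym (nonNbrsOn-∷-true w c (d ∷ r) wc)) (s≤s (proj₂ noRoom wd)) ,
          λ wc′ → ⊥-elim (true≢false (trans (sym wc) wc′)))
  ...   | inj₂ wc | _ =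
    inj₂ (subst (λ k → length (c ∷ d ∷ r) ≤ suc (2 * k)) m≡ (m≤n⇒m≤1+n strong) ,
          λ _ → subst (λ k → length (c ∷ d ∷ r) ≤ 2 * k) m≡ strong)
    where
    m≡ : suc (nonNbrsOn w (d ∷ r)) ≡ nonNbrsOn w (c ∷ d ∷ r)
    m≡ = sym (nonNbrsOn-∷-false w c (d ∷ r) wc)
    strong : length (c ∷ d ∷ r) ≤ 2 * suc (nonNbrsOn w (d ∷ r))
    strong = subst (length (c ∷ d ∷ r) ≤_) (sym (*-suc 2 (nonNbrsOn w (d ∷ r)))) (s≤s (proj₁ noRoom))

data Adjacent {A : Set} (u w : A) : List A → Set where
  here  : ∀ {xs} → Adjacent u w (u ∷ w ∷ xs)
  there : ∀ {x xs} → Adjacent u w xs → Adjacent u w (x ∷ xs)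

module _ {A : Set} where

  adjacent-++ : ∀ {u w : A} xs {ys} → last xs ≡ just u → Adjacent u w (xs ++ w ∷ ys)
  adjacent-++ (x ∷ []) refl = here
  adjacent-++ (x ∷ x′ ∷ xs) e = there (adjacent-++ (x′ ∷ xs) e)

  last-++ : ∀ (xs : List A) y ys → last (xs ++ y ∷ ys) ≡ last (y ∷ ys)
  last-++ [] y ys = refl
  last-++ (x ∷ []) y ys = refl
  last-++ (x ∷ x′ ∷ xs) y ys = last-++ (x′ ∷ xs) y ys

  linked-adjacent : ∀ {R : A → A → Set} {u w xs} → Linked R xs → Adjacent u w xs → R u w
  linked-adjacent (r ∷ _) here = r
  linked-adjacent (_ ∷ rs) (there adj) = linked-adjacent rs adj

  lookup-adjacent : ∀ (xs : List A) (i j : Fin (length xs)) → toℕ j ≡ suc (toℕ i) →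
                    Adjacent (lookup xs i) (lookup xs j) xs
  lookup-adjacent (x ∷ y ∷ xs) zero (suc zero) refl = here
  lookup-adjacent (x ∷ xs) (suc i) (suc j) e = there (lookup-adjacent xs i j (suc-injective e))
  lookup-adjacent (x ∷ []) zero (suc ()) e
  lookup-adjacent (x ∷ y ∷ xs) zero (suc (suc j)) ()

  adjacent-lookup : ∀ {u w : A} {xs} → Adjacent u w xs →
                    ∃₂ λ (i j : Fin (length xs)) → toℕ j ≡ suc (toℕ i) × lookup xs i ≡ u × lookup xs j ≡ w
  adjacent-lookup here = zero , suc zero , refl , refl , refl
  adjacent-lookup (there adj) with adjacent-lookup adj
  ... | i , j , e , ei , ej = suc i , suc j , cong suc e , ei , ej

  last-lookup : ∀ (xs : List A) (i : Fin (length xs)) → suc (toℕ i) ≡ length xs → last xs ≡ just (lookup xs i)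
  last-lookup (x ∷ []) zero e = refl
  last-lookup (x ∷ y ∷ xs) (suc i) e = last-lookup (y ∷ xs) i (suc-injective e)
  last-lookup (x ∷ []) (suc ()) e
  last-lookup (x ∷ y ∷ xs) zero ()

  index-∈-lookup : ∀ (xs : List A) i → index (∈-lookup {xs = xs} i) ≡ i
  index-∈-lookup (x ∷ xs) zero = refl
  index-∈-lookup (x ∷ xs) (suc i) = cong suc (index-∈-lookup xs i)

next-spec : ∀ {m} (i : Fin (suc m)) → toℕ (next i) ≡ suc (toℕ i) ⊎ (next i ≡ zero × suc (toℕ i) ≡ suc m)
next-spec {m} i with suc (toℕ i) ℕ.<? suc m
... | yes lt = inj₁ (toℕ-fromℕ< lt)
... | no ¬lt = inj₂ (refl , ≤-antisym (toℕ<n i) (≮⇒≥ ¬lt))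

module ListCycle {m} (G : Graph (suc m)) (c : Fin (suc m)) (cs : List (Fin (suc m)))
  (linked : Linked (Edge G) (c ∷ cs)) (unique : Unique (c ∷ cs)) (complete : ∀ v → v ∈ c ∷ cs)
  (ℓ : Fin (suc m)) (ends : last (c ∷ cs) ≡ just ℓ) (closing : Edge G ℓ c) where

  C : List (Fin (suc m))
  C = c ∷ cs

  -- By the pigeonhole principle in both directions, C lists every vertex exactly once.
  length-C : length C ≡ suc m
  length-C = ≤-antisym (≤-trans (pigeonhole unique (λ {v} _ → ∈-allFin v)) (≤-reflexive length-allFin))
                       (≤-trans (≤-reflexive (sym length-allFin))
                                (pigeonhole (Unique.allFin⁺ (suc m)) (λ {v} _ → complete v)))
    where
    length-allFin : length (allFin (suc m)) ≡ suc m
    length-allFin = length-tabulate (λ i → i)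

  position : Fin (suc m) → Fin (length C)
  position = cast (sym length-C)

  unposition : Fin (length C) → Fin (suc m)
  unposition = cast length-C

  at : Fin (suc m) → Fin (suc m)
  at i = lookup C (position i)

  at-unposition : ∀ k → at (unposition k) ≡ lookup C k
  at-unposition k = cong (lookup C) (cast-involutive (sym length-C) length-C k)

  at-index : ∀ v → at (unposition (index (complete v))) ≡ v
  at-index v = trans (at-unposition (index (complete v))) (sym (lookup-index (complete v)))

  index-at : ∀ i → unposition (index (complete (at i))) ≡ i
  index-at i = begin
      unposition (index (complete (at i)))                 ≡⟨ cong (λ p → unposition (index p)) same-proof ⟩
      unposition (index (∈-lookup {xs = C} (position i)))  ≡⟨ cong unposition (index-∈-lookup C (position i)) ⟩
      unposition (position i)                              ≡⟨ cast-involutive length-C (sym length-C) i ⟩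
      i                                                    ∎
    where
    open ≡-Reasoning
    same-proof : complete (at i) ≡ ∈-lookup (position i)
    same-proof = unique⇒irrelevant (≡.setoid _) (Decidable⇒UIP.≡-irrelevant Fin._≟_) unique _ _

  σ : Permutation′ (suc m)
  σ = permutation at (λ v → unposition (index (complete v))) at-index index-at

  at-last : ∀ i → suc (toℕ i) ≡ suc m → at i ≡ ℓ
  at-last i e = just-injective (trans (sym (last-lookup C (position i) last-position)) ends)
    where
    last-position : suc (toℕ (position i)) ≡ length C
    last-position = trans (cong suc (toℕ-cast _ i)) (trans e (sym length-C))

  hamiltonian : IsHamCycle G σ
  hamiltonian i with next-spec i
  ... | inj₁ e = linked-adjacent linked (lookup-adjacent C (position i) (position (next i))
                                          (trans (toℕ-cast _ (next i)) (trans e (cong suc (sym (toℕ-cast _ i))))))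
  ... | inj₂ (e , wraps) rewrite e | at-last i wraps = closing

  uses-adjacent : ∀ {u w} → Adjacent u w C → UsesEdge σ u w
  uses-adjacent adj with adjacent-lookup adj
  ... | i , j , j≡1+i , refl , refl with next-spec (unposition i)
  ...   | inj₁ e = unposition i , inj₁ (at-unposition i , cong (lookup C) (toℕ-injective (begin
             toℕ (position (next (unposition i)))  ≡⟨ toℕ-cast _ _ ⟩
             toℕ (next (unposition i))             ≡⟨ e ⟩
             suc (toℕ (unposition i))              ≡⟨ cong suc (toℕ-cast _ i) ⟩
             suc (toℕ i)                           ≡⟨ sym j≡1+i ⟩
             toℕ j                                 ∎)))
    where open ≡-Reasoning
  ...   | inj₂ (_ , wraps) =
    ⊥-elim (<-irrefl (trans j≡1+i (trans (cong suc (sym (toℕ-cast _ i))) (trans wraps (sym length-C)))) (toℕ<n j))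

  uses-closing : UsesEdge σ c ℓ
  uses-closing with next-spec (fromℕ m)
  ... | inj₁ e = ⊥-elim (<-irrefl (trans e (cong suc (toℕ-fromℕ m))) (toℕ<n (next (fromℕ m))))
  ... | inj₂ (e , wraps) = fromℕ m , inj₂ (at-last (fromℕ m) wraps , cong at e)

nonNbrs : ∀ {n} → Graph n → Subset n → Fin n → ℕ
nonNbrs {n} G X v = count (λ u → X u ∧ not (adj G v u)) (allFin n)

record XPath {n} (G : Graph n) (X : Subset n) (u v : Fin n) : Set where
  field
    tail   : List (Fin n)
    linked : Linked (Edge G) (u ∷ tail)
    unique : Unique (u ∷ tail)
    inside : All (λ w → X w ≡ true) (u ∷ tail)
    ends   : last (u ∷ tail) ≡ just v

SpanningPath : ∀ {n} → Graph n → Subset n → Fin n → Fin n → Set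
SpanningPath G X u v = Σ (XPath G X u v) λ q → ∀ w → X w ≡ true → w ∈ u ∷ XPath.tail q

neighbour-cover : ∀ a x e → a ∧ x ≡ true → (a ∧ (x ∧ not e)) ∨ e ≡ true
neighbour-cover true true false _ = refl
neighbour-cover true true true  _ = refl

common-cover : ∀ a x e b → a ∧ x ≡ true → ((b ∧ (x ∧ not e)) ∧ a) ∨ (e ∨ (x ∧ not b)) ≡ true
common-cover true true false true  _ = refl
common-cover true true false false _ = refl
common-cover true true true  true  _ = refl
common-cover true true true  false _ = refl

module HamiltonPathInDenseSet {n} (G : Graph n) (X E : Subset n) (s : ℕ)
  (E⊆X : ∀ v → E v ≡ true → X v ≡ true)
  (few-non-nbrs : ∀ v → X v ≡ true → E v ≡ false → nonNbrs G X v ≤ s)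
  (high-deg : ∀ v → X v ≡ true → 4 * ∣ E ∣ₛ + 3 * s + 5 < deg G v X) where

  V : Set
  V = Fin n

  open import Data.List.Relation.Binary.Permutation.Setoid.Properties (≡.setoid V) using (Unique-resp-↭)
  open import Data.List.Membership.DecPropositional (Fin._≟_ {n}) using (_∈?_)

  k : ℕ
  k = ∣ E ∣ₛ

  good : V → Bool
  good v = X v ∧ not (E v)

  -- Paths with at most cap vertices can still be extended by three vertices.
  cap : ℕ
  cap = 3 * k + 2 * s + 2

  Small : List V → Set
  Small excl = length excl ≤ 3 + cap

  small-room : ∀ {excl} v → Small excl → X v ≡ true → length excl + k + s < deg G v X
  small-room {excl} v small Xv = ≤-<-trans bound (high-deg v Xv)
    where
    total : ∀ k s → 3 + (3 * k + 2 * s + 2) + k + s ≡ 4 * k + 3 * s + 5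
    total = solve-∀
    bound : length excl + k + s ≤ 4 * k + 3 * s + 5
    bound = ≤-trans (+-monoˡ-≤ s (+-monoˡ-≤ k small)) (≤-reflexive (total k s))

  good-neighbour : ∀ u → X u ≡ true → ∀ excl → Small excl → ∃ λ g → good g ≡ true × Edge G u g × g ∉ excl
  good-neighbour u Xu excl small with pick Fin._≟_ Q excl (Unique.allFin⁺ n) enough
    where
    Q : V → Bool
    Q w = adj G u w ∧ good w
    enough : length excl < count Q (allFin n)
    enough = +-cancelʳ-< k (length excl) _ (<-≤-trans (≤-<-trans (m≤m+n _ s) (small-room {excl} u small Xu))
               (≤-trans (count-mono (λ w → neighbour-cover (adj G u w) (X w) (E w)) (allFin n)) (count-∨ Q E (allFin n))))
  ... | g , _ , Qg , g∉ = g , proj₂ (∧-true {adj G u g} Qg) , proj₁ (∧-true {adj G u g} Qg) , g∉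

  common-good-neighbour : ∀ u t → good u ≡ true → X t ≡ true → ∀ excl → Small excl →
                          ∃ λ g → good g ≡ true × Edge G u g × Edge G t g × g ∉ excl
  common-good-neighbour u t good-u Xt excl small with pick Fin._≟_ Q excl (Unique.allFin⁺ n) enough
    where
    Q : V → Bool
    Q w = (adj G u w ∧ good w) ∧ adj G t w
    Bad : V → Bool
    Bad w = E w ∨ (X w ∧ not (adj G u w))
    bad-count : count Bad (allFin n) ≤ k + s
    bad-count = ≤-trans (count-∨ E _ (allFin n))
                        (+-monoʳ-≤ k (few-non-nbrs u (proj₁ (∧-true good-u)) (not-true (proj₂ (∧-true good-u)))))
    enough : length excl < count Q (allFin n)
    enough = +-cancelʳ-< (k + s) (length excl) _
               (<-≤-trans (subst (_< deg G t X) (+-assoc (length excl) k s) (small-room {excl} t small Xt))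
               (≤-trans (count-mono (λ w → common-cover (adj G t w) (X w) (E w) (adj G u w)) (allFin n))
                 (≤-trans (count-∨ Q Bad (allFin n)) (+-monoʳ-≤ _ bad-count))))
  ... | g , _ , Qg , g∉ with ∧-true {adj G u g ∧ good g} Qg
  ... | uQg , tg = g , proj₂ (∧-true {adj G u g} uQg) , proj₁ (∧-true {adj G u g} uQg) , tg , g∉

  module Between (x y : V) (x≢y : x ≢ y) (Xx : X x ≡ true) (Xy : X y ≡ true) where

    record Path : Set where
      field
        end    : V
        rest   : List V
        linked : Linked (Edge G) (end ∷ rest)
        unique : Unique (end ∷ rest)
        inside : All (λ w → X w ≡ true) (end ∷ rest)
        starts : last (end ∷ rest) ≡ just x
        avoids : y ∉ end ∷ rest
    open Path

    vertices : Path → List V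
    vertices p = end p ∷ rest p

    size : Path → ℕ
    size p = length (vertices p)

    _⊑_ : Path → Path → Set
    p ⊑ p′ = vertices p ⊆ vertices p′

    start : Path
    start = record { end = x ; rest = [] ; linked = [-] ; unique = [] ∷ [] ; inside = Xx ∷ []
                   ; starts = refl ; avoids = λ { (here y≡x) → x≢y (sym y≡x) } }

    extend : (p : Path) (v : V) → Edge G (end p) v → v ∉ y ∷ vertices p → X v ≡ true → Path
    extend p v e v∉ Xv = record
      { end    = v
      ; rest   = vertices p
      ; linked = trans (adj-sym G v (end p)) e ∷ linked p
      ; unique = ¬Any⇒All¬ _ (λ v∈ → v∉ (there v∈)) ∷ unique p
      ; inside = Xv ∷ inside p
      ; starts = starts p
      ; avoids = λ { (here y≡v) → v∉ (here (sym y≡v)) ; (there y∈) → avoids p y∈ }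
      }

    Bridge : Path → V → Set
    Bridge p t = Σ Path λ p′ → p ⊑ p′ × size p′ ≡ 2 + size p × Edge G (end p′) t × t ∉ vertices p′

    bridge : (p : Path) (t : V) → X t ≡ true → t ∉ vertices p → size p ≤ cap → Bridge p t
    bridge p t Xt t∉p small =
      second (good-neighbour (end p) (All.head (inside p)) (t ∷ y ∷ vertices p) (s≤s (s≤s (m≤n⇒m≤1+n small))))
      where
      second : (∃ λ g → good g ≡ true × Edge G (end p) g × g ∉ t ∷ y ∷ vertices p) → Bridge p t
      second (g₁ , good₁ , e₁ , g₁∉) =
        finish (common-good-neighbour g₁ t good₁ Xt (t ∷ y ∷ vertices p₁) (s≤s (s≤s (s≤s small))))
        where
        p₁ : Path
        p₁ = extend p g₁ e₁ (λ g₁∈ → g₁∉ (there g₁∈)) (proj₁ (∧-true good₁))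
        finish : (∃ λ g → good g ≡ true × Edge G g₁ g × Edge G t g × g ∉ t ∷ y ∷ vertices p₁) → Bridge p t
        finish (g₂ , good₂ , e₂ , t-g₂ , g₂∉) =
          extend p₁ g₂ e₂ (λ g₂∈ → g₂∉ (there g₂∈)) (proj₁ (∧-true good₂)) ,
          (λ w → there (there w)) , refl , trans (adj-sym G g₂ t) t-g₂ , t∉
          where
          t∉ : t ∉ g₂ ∷ g₁ ∷ vertices p
          t∉ (here t≡g₂) = g₂∉ (here (sym t≡g₂))
          t∉ (there (here t≡g₁)) = g₁∉ (here (sym t≡g₁))
          t∉ (there (there t∈)) = t∉p t∈

    connect : (p : Path) (t : V) → t ∉ y ∷ vertices p → X t ≡ true → size p ≤ cap →
              Σ Path λ p′ → p ⊑ p′ × size p′ ≡ 3 + size p × t ∈ vertices p′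
    connect p t t∉ Xt small =
      let p′ , sub , size≡ , e , t∉p′ = bridge p t Xt (λ t∈ → t∉ (there t∈)) small
          t∉′ : t ∉ y ∷ vertices p′
          t∉′ = λ { (here t≡y) → t∉ (here t≡y) ; (there t∈) → t∉p′ t∈ }
      in extend p′ t e t∉′ Xt , (λ w → there (sub w)) , cong suc size≡ , here refl

    -- While absorbing exceptional vertices the path has at most 1 + 3k vertices.
    absorbed≤cap : 1 + 3 * k ≤ cap
    absorbed≤cap = ≤-trans (≤-reflexive (+-comm 1 (3 * k))) (+-mono-≤ (m≤m+n (3 * k) (2 * s)) (s≤s z≤n))

    Absorbs : Path → V → Set
    Absorbs p v = Σ Path λ p′ → p ⊑ p′ × size p′ ≤ 3 + size p × (E v ≡ true → v ∈ y ∷ vertices p′)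

    absorb-one : (p : Path) (v : V) → 3 + size p ≤ 1 + 3 * k → Absorbs p v
    absorb-one p v budget = cases (true-or-false (E v)) (v ∈? (y ∷ vertices p))
      where
      cases : E v ≡ true ⊎ E v ≡ false → Dec (v ∈ y ∷ vertices p) → Absorbs p v
      cases (inj₂ Ev) _ = p , (λ w → w) , m≤n+m (size p) 3 , λ Ev′ → ⊥-elim (true≢false (trans (sym Ev′) Ev))
      cases (inj₁ _) (yes v∈) = p , (λ w → w) , m≤n+m (size p) 3 , λ _ → v∈
      cases (inj₁ Ev) (no v∉) =
        let p′ , sub , size≡ , v∈ = connect p v v∉ (E⊆X v Ev) (≤-trans (m≤n+m (size p) 3) (≤-trans budget absorbed≤cap))
        in p′ , sub , ≤-reflexive size≡ , λ _ → there v∈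

    three-more : ∀ a b → a + 3 * suc b ≡ 3 + a + 3 * b
    three-more = solve-∀

    absorb : (todo : List V) (p : Path) → size p + 3 * length todo ≤ 1 + 3 * k →
             Σ Path λ p′ → p ⊑ p′ × size p′ ≤ 1 + 3 * k × (∀ {v} → v ∈ todo → E v ≡ true → v ∈ y ∷ vertices p′)
    absorb [] p budget = p , (λ w → w) , subst (_≤ 1 + 3 * k) (+-identityʳ (size p)) budget , λ ()
    absorb (v ∷ todo) p budget =
      let budget′ = subst (_≤ 1 + 3 * k) (three-more (size p) (length todo)) budget
          p₁ , sub₁ , size₁ , v-in = absorb-one p v (≤-trans (m≤m+n (3 + size p) (3 * length todo)) budget′)
          p₂ , sub₂ , size₂ , todo-in = absorb todo p₁ (≤-trans (+-monoˡ-≤ (3 * length todo) size₁) budget′)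
          lift : ∀ {u} → u ∈ y ∷ vertices p₁ → u ∈ y ∷ vertices p₂
          lift = λ { (here u≡y) → here u≡y ; (there u∈) → there (sub₂ u∈) }
      in p₂ , (λ w → sub₂ (sub₁ w)) , size₂ , λ { (here refl) Ev → lift (v-in Ev) ; (there w) Ev → todo-in w Ev }

    pad : (r : ℕ) (p : Path) → size p + r ≤ cap → Σ Path λ p′ → p ⊑ p′ × size p′ ≡ r + size p
    pad zero p _ = p , (λ w → w) , refl
    pad (suc r) p room =
      let g , good-g , e , g∉ = good-neighbour (end p) (All.head (inside p)) (y ∷ vertices p)
                                  (s≤s (m≤n⇒m≤1+n (m≤n⇒m≤1+n (≤-trans (m≤m+n (size p) (suc r)) room))))
          p′ , sub , size≡ = pad r (extend p g e g∉ (proj₁ (∧-true good-g))) (subst (_≤ cap) (+-suc (size p) r) room)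
      in p′ , (λ w → sub (there w)) , trans size≡ (+-suc r (size p))

    close : (p : Path) → size p ≤ cap → Σ (XPath G X y x) λ q → vertices p ⊆ XPath.tail q
    close p small =
      let p′ , sub , _ , e , _ = bridge p y Xy (avoids p) small
      in record { tail = vertices p′ ; linked = trans (adj-sym G y (end p′)) e ∷ linked p′
                ; unique = ¬Any⇒All¬ _ (avoids p′) ∷ unique p′ ; inside = Xy ∷ inside p′ ; ends = starts p′ } , sub

    open XPath

    -- Paths from y to x that are long enough for every remaining good vertex to be inserted.
    Long : XPath G X y x → Set
    Long q = 2 + 2 * s ≤ length (y ∷ tail q)

    Absorbing : XPath G X y x → Set
    Absorbing q = ∀ v → E v ≡ true → v ∈ y ∷ tail q

    _≼_ : XPath G X y x → XPath G X y x → Set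
    q ≼ q′ = (y ∷ tail q) ⊆ (y ∷ tail q′)

    insert-vertex : (q : XPath G X y x) → Long q → Absorbing q → (v : V) →
                    Σ (XPath G X y x) λ q′ → q ≼ q′ × (X v ≡ true → v ∈ y ∷ tail q′)
    insert-vertex q long absorbing v = cases (true-or-false (X v)) (v ∈? (y ∷ tail q))
      where
      Result : Set
      Result = Σ (XPath G X y x) λ q′ → q ≼ q′ × (X v ≡ true → v ∈ y ∷ tail q′)

      inserted : X v ≡ true → v ∉ y ∷ tail q → Insertion.Inserted G v y (tail q) → Result
      inserted Xv v∉ (t′ , v∷t↭t′ , linked′ , ends′) = q′ , sub , λ _ → there (∈-resp-↭ v∷t↭t′ (here refl))
        where
        v∷q↭q′ : v ∷ y ∷ tail q ↭ y ∷ t′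
        v∷q↭q′ = ↭.trans (↭.swap v y ↭.refl) (↭.prep y v∷t↭t′)
        q′ : XPath G X y x
        q′ = record { tail = t′ ; linked = linked′
                    ; unique = Unique-resp-↭ (↭⇒↭ₛ v∷q↭q′) (¬Any⇒All¬ _ v∉ ∷ unique q)
                    ; inside = All-resp-↭ v∷q↭q′ (Xv ∷ inside q) ; ends = trans ends′ (ends q) }
        sub : q ≼ q′
        sub (here w≡y) = here w≡y
        sub (there w∈) = there (∈-resp-↭ v∷t↭t′ (there w∈))

      -- Failure would put half of the path among the at most s non-neighbours of v.
      no-room : X v ≡ true → E v ≡ false → ¬ Insertion.NoRoom G v y (tail q)
      no-room Xv Ev (short , _) = <-irrefl refl (≤-trans long (≤-trans short (s≤s (*-monoʳ-≤ 2 few))))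
        where
        few : Insertion.nonNbrsOn G v (y ∷ tail q) ≤ s
        few = ≤-trans (count-≤ (unique q) (λ w∈ nw → ∈-allFin _ , ∧-intro (All.lookup (inside q) w∈) nw))
                      (few-non-nbrs v Xv Ev)

      cases : X v ≡ true ⊎ X v ≡ false → Dec (v ∈ y ∷ tail q) → Result
      cases (inj₂ Xv) _ = q , (λ w → w) , λ Xv′ → ⊥-elim (true≢false (trans (sym Xv′) Xv))
      cases (inj₁ _) (yes v∈) = q , (λ w → w) , λ _ → v∈
      cases (inj₁ Xv) (no v∉) with true-or-false (E v)
      ... | inj₁ Ev = ⊥-elim (v∉ (absorbing v Ev))
      ... | inj₂ Ev = [ inserted Xv v∉ , (λ nr → ⊥-elim (no-room Xv Ev nr)) ]′
                        (Insertion.insert G v y (tail q) (linked q))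

    fill : (todo : List V) (q : XPath G X y x) → Long q → Absorbing q →
           Σ (XPath G X y x) λ q′ → q ≼ q′ × (∀ {v} → v ∈ todo → X v ≡ true → v ∈ y ∷ tail q′)
    fill [] q _ _ = q , (λ w → w) , λ ()
    fill (v ∷ todo) q long absorbing =
      let q₁ , sub₁ , v-in = insert-vertex q long absorbing v
          q₂ , sub₂ , todo-in = fill todo q₁ (≤-trans long (pigeonhole (unique q) sub₁)) (λ u Eu → sub₁ (absorbing u Eu))
      in q₂ , (λ w → sub₂ (sub₁ w)) , λ { (here refl) Xv → sub₂ (v-in Xv) ; (there w) Xw → todo-in w Xw }

    pad-length : ∀ a → a ≤ 1 + 3 * k → (1 + 2 * s) + a ≤ cap
    pad-length a a≤ = ≤-trans (+-monoʳ-≤ (1 + 2 * s) a≤) (≤-reflexive (total k s))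
      where
      total : ∀ k s → (1 + 2 * s) + (1 + 3 * k) ≡ 3 * k + 2 * s + 2
      total = solve-∀

    hamilton-path : SpanningPath G X y x
    hamilton-path =
      let p₁ , _ , size₁ , exceptional-in = absorb (filter (λ v → E v Data.Bool.≟ true) (allFin n)) start ≤-refl
          p₂ , sub₂ , size₂ = pad (1 + 2 * s) p₁ (subst (_≤ cap) (+-comm (1 + 2 * s) (size p₁)) (pad-length (size p₁) size₁))
          q , sub₃ = close p₂ (subst (_≤ cap) (sym size₂) (pad-length (size p₁) size₁))
          long : Long q
          long = s≤s (≤-trans (≤-trans (m≤m+n (1 + 2 * s) (size p₁)) (≤-reflexive (sym size₂)))
                              (pigeonhole (unique p₂) sub₃))
          absorbing : Absorbing q
          absorbing = λ v Ev → [ here , (λ v∈ → there (sub₃ (sub₂ v∈))) ]′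
                        (toSum (exceptional-in (∈-filter⁺ (λ v → E v Data.Bool.≟ true) (∈-allFin v) Ev) Ev))
          q′ , _ , spans = fill (allFin n) q long absorbing
      in q′ , λ v Xv → spans (∈-allFin v) Xv

-- The hypotheses are stated over ℚ; with ε ≤ ε₀ = 1/1000 they become inequalities
-- between natural numbers scaled by 1000.
module RationalBounds where
  open import Data.Integer as ℤ using (+_)
  import Data.Integer.Properties as ℤₚ
  import Data.Rational.Properties as ℚₚ
  open import Data.Rational.Unnormalised as ℚᵘ using (mkℚᵘ; *≤*)
  import Data.Rational.Unnormalised.Properties as ℚᵘₚ
  open import Relation.Binary.PropositionalEquality using (subst₂)

  ε₀ : ℚ
  ε₀ = + 1 ℚ./ 1000

  0<ε₀ : 0ℚ ℚ.< ε₀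
  0<ε₀ = ℚₚ.positive⁻¹ ε₀

  toℚᵘ-⟦⟧ : ∀ n → ℚ.toℚᵘ ⟦ n ⟧ ℚᵘ.≃ mkℚᵘ (+ n) 0
  toℚᵘ-⟦⟧ n = ℚₚ.toℚᵘ-fromℚᵘ (mkℚᵘ (+ n) 0)

  ⟦⟧-nonNeg : ∀ n → ℚ.NonNegative ⟦ n ⟧
  ⟦⟧-nonNeg n = ℚₚ.normalize-nonNeg n 1

  private
    numerator : ∀ p n → (+ p ℤ.* + n) ℤ.* + 1 ≡ + (p * n)
    numerator p n = trans (ℤₚ.*-identityʳ _) (sym (ℤₚ.pos-* p n))

    denominator : ∀ q d → + d ℤ.* + suc (q * 1) ≡ + (suc q * d)
    denominator q d = trans (sym (ℤₚ.pos-* d _)) (cong +_ (trans (*-comm d _) (cong (λ z → suc z * d) (*-identityʳ q))))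

  scaled-≤ : ∀ {c : ℚ} {p q} → ℚ.toℚᵘ c ≡ mkℚᵘ (+ p) q → ∀ n d → c ℚ.* ⟦ n ⟧ ℚ.≤ ⟦ d ⟧ → p * n ≤ suc q * d
  scaled-≤ {c} {p} {q} c≡ n d c*n≤d
    with ℚᵘₚ.≤-respʳ-≃ (toℚᵘ-⟦⟧ d) (ℚᵘₚ.≤-respˡ-≃ (ℚᵘₚ.*-cong (ℚᵘₚ.≃-reflexive c≡) (toℚᵘ-⟦⟧ n))
           (ℚᵘₚ.≤-respˡ-≃ (ℚₚ.toℚᵘ-homo-* c ⟦ n ⟧) (ℚₚ.toℚᵘ-mono-≤ c*n≤d)))
  ... | *≤* le = ℤₚ.drop‿+≤+ (subst₂ ℤ._≤_ (numerator p n) (denominator q d) le)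

  ≤-scaled : ∀ {c : ℚ} {p q} → ℚ.toℚᵘ c ≡ mkℚᵘ (+ p) q → ∀ n d → ⟦ d ⟧ ℚ.≤ c ℚ.* ⟦ n ⟧ → suc q * d ≤ p * n
  ≤-scaled {c} {p} {q} c≡ n d d≤c*n
    with ℚᵘₚ.≤-respˡ-≃ (toℚᵘ-⟦⟧ d) (ℚᵘₚ.≤-respʳ-≃ (ℚᵘₚ.*-cong (ℚᵘₚ.≃-reflexive c≡) (toℚᵘ-⟦⟧ n))
           (ℚᵘₚ.≤-respʳ-≃ (ℚₚ.toℚᵘ-homo-* c ⟦ n ⟧) (ℚₚ.toℚᵘ-mono-≤ d≤c*n)))
  ... | *≤* le = ℤₚ.drop‿+≤+ (subst₂ ℤ._≤_ (denominator q d) (numerator p n) le)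

  few-⟦⟧ : ∀ {ε} → ε ℚ.≤ ε₀ → ∀ a n → ⟦ a ⟧ ℚ.≤ ε ℚ.* ⟦ n ⟧ → 1000 * a ≤ 1 * n
  few-⟦⟧ ε≤ε₀ a n a≤εn = ≤-scaled {ε₀} refl n a (ℚₚ.≤-trans a≤εn (ℚₚ.*-monoʳ-≤-nonNeg ⟦ n ⟧ {{⟦⟧-nonNeg n}} ε≤ε₀))

  -- "At least (c - ε)n" with ε ≤ 1/1000 and c - 1/1000 = p/1000 means at least pn/1000.
  many-⟦⟧ : ∀ {ε} (c : ℚ) {p} → ℚ.toℚᵘ (c ℚ.- ε₀) ≡ mkℚᵘ (+ p) 999 → ε ℚ.≤ ε₀ → ∀ n d →
            (c ℚ.- ε) ℚ.* ⟦ n ⟧ ℚ.≤ ⟦ d ⟧ → p * n ≤ 1000 * d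
  many-⟦⟧ c c≡ ε≤ε₀ n d le =
    scaled-≤ c≡ n d (ℚₚ.≤-trans (ℚₚ.*-monoʳ-≤-nonNeg ⟦ n ⟧ {{⟦⟧-nonNeg n}} (ℚₚ.+-monoʳ-≤ c (ℚₚ.neg-antimono-≤ ε≤ε₀))) le)

  half-⟦⟧ : ∀ {ε} → ε ℚ.≤ ε₀ → ∀ n d → (ℚ.½ ℚ.- ε) ℚ.* ⟦ n ⟧ ℚ.≤ ⟦ d ⟧ → 499 * n ≤ 1000 * d
  half-⟦⟧ = many-⟦⟧ ℚ.½ refl

  quarter-⟦⟧ : ∀ {ε} → ε ℚ.≤ ε₀ → ∀ n d → (¼ ℚ.- ε) ℚ.* ⟦ n ⟧ ℚ.≤ ⟦ d ⟧ → 249 * n ≤ 1000 * d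
  quarter-⟦⟧ = many-⟦⟧ ¼ refl

open RationalBounds using (ε₀; 0<ε₀; few-⟦⟧; half-⟦⟧; quarter-⟦⟧)

-- Arithmetic: a good vertex v of X has few non-neighbours in X.  Here a, b, c are the
-- numbers of non-neighbours and neighbours of v in X and the size of the other side.
non-nbrs-bound : ∀ {n a b c} → (b + a) + c ≡ n → 499 * n ≤ 1000 * b → 499 * n ≤ 1000 * c → a ≤ n / 500
non-nbrs-bound {n} {a} {b} {c} total b-large c-large = begin
    a               ≡⟨ sym (m*n/n≡m a 500) ⟩
    a * 500 / 500   ≤⟨ /-monoˡ-≤ {m = a * 500} {n = n} 500 a*500≤n ⟩
    n / 500         ∎
  where
  open ≤-Reasoning
  expand : ∀ a b c → 2 * (a * 500) + (1000 * b + 1000 * c) ≡ 1000 * ((b + a) + c)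
  expand = solve-∀
  split : ∀ n → 1000 * n ≡ 2 * n + 998 * n
  split = solve-∀
  double : ∀ n → 499 * n + 499 * n ≡ 998 * n
  double = solve-∀
  key : 2 * (a * 500) + 998 * n ≤ 2 * n + 998 * n
  key = begin
    2 * (a * 500) + 998 * n                    ≡⟨ cong (2 * (a * 500) +_) (sym (double n)) ⟩
    2 * (a * 500) + (499 * n + 499 * n)        ≤⟨ +-monoʳ-≤ (2 * (a * 500)) (+-mono-≤ b-large c-large) ⟩
    2 * (a * 500) + (1000 * b + 1000 * c)      ≡⟨ expand a b c ⟩
    1000 * ((b + a) + c)                       ≡⟨ cong (1000 *_) total ⟩
    1000 * n                                   ≡⟨ split n ⟩
    2 * n + 998 * n                            ∎
  a*500≤n : a * 500 ≤ n
  a*500≤n = *-cancelˡ-≤ 2 (+-cancelʳ-≤ (998 * n) (2 * (a * 500)) (2 * n) key)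

high-deg-bound : ∀ {n e d} → 21 ≤ n → 1000 * e ≤ 1 * n → 249 * n ≤ 1000 * d → 4 * e + 3 * (n / 500) + 5 < d
high-deg-bound {n} {e} {d} n≥21 e-few d-large = *-cancelˡ-< 1000 _ _ (begin-strict
    1000 * (4 * e + 3 * (n / 500) + 5)              ≡⟨ expand e (n / 500) ⟩
    4 * (1000 * e) + 6 * (n / 500 * 500) + 5000     ≤⟨ +-monoˡ-≤ 5000 (+-mono-≤ (*-monoʳ-≤ 4 e-few) (*-monoʳ-≤ 6 round-down)) ⟩
    4 * (1 * n) + 6 * n + 5000                      ≡⟨ collect n ⟩
    10 * n + 5000                                   <⟨ +-monoʳ-< (10 * n) n-large ⟩
    10 * n + 239 * n                                ≡⟨ sum n ⟩
    249 * n                                         ≤⟨ d-large ⟩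
    1000 * d                                        ∎)
  where
  open ≤-Reasoning
  expand : ∀ e q → 1000 * (4 * e + 3 * q + 5) ≡ 4 * (1000 * e) + 6 * (q * 500) + 5000
  expand = solve-∀
  collect : ∀ n → 4 * (1 * n) + 6 * n + 5000 ≡ 10 * n + 5000
  collect = solve-∀
  sum : ∀ n → 10 * n + 239 * n ≡ 249 * n
  sum = solve-∀
  round-down : n / 500 * 500 ≤ n
  round-down = m/n*n≤m n 500
  n-large : 5000 < 239 * n
  n-large = <-≤-trans (≤ᵇ⇒≤ 5001 (239 * 21) _) (*-monoʳ-≤ 239 n≥21)

-- Conditions (A2)–(A3), or (A4)–(A5), for one side X in integer form (ε ≤ 1/1000).
record DenseSide {n} (G : Graph n) (X : Subset n) : Set where
  field
    exceptional     : Subset n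
    exceptional⊆X   : ∀ v → exceptional v ≡ true → X v ≡ true
    few-exceptional : 1000 * ∣ exceptional ∣ₛ ≤ 1 * n
    good-deg        : ∀ v → X v ≡ true → exceptional v ≡ false → 499 * n ≤ 1000 * deg G v X
    min-deg         : ∀ v → X v ≡ true → 249 * n ≤ 1000 * deg G v X

dense-side : ∀ {ε n} {G : Graph n} {X : Subset n} → ε ℚ.≤ ε₀ → AllButFew G X ε →
             (∀ v → X v ≡ true → (¼ ℚ.- ε) ℚ.* ⟦ n ⟧ ℚ.≤ ⟦ deg G v X ⟧) → DenseSide G X
dense-side {n = n} {G} {X} ε≤ε₀ (E , E⊆X , E-few , E-deg) min = record
  { exceptional     = E
  ; exceptional⊆X   = E⊆X
  ; few-exceptional = few-⟦⟧ ε≤ε₀ ∣ E ∣ₛ n E-few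
  ; good-deg        = λ v Xv Ev → half-⟦⟧ ε≤ε₀ n (deg G v X) (E-deg v Xv Ev)
  ; min-deg         = λ v Xv → quarter-⟦⟧ ε≤ε₀ n (deg G v X) (min v Xv)
  }

deg≤size : ∀ {n} (G : Graph n) (Z : Subset n) v → deg G v Z ≤ ∣ Z ∣ₛ
deg≤size {n} G Z v = count-mono (λ u e → proj₂ (∧-true {adj G v u} e)) (allFin n)

degree-split : ∀ {n} (G : Graph n) (X : Subset n) v → ∣ X ∣ₛ ≡ deg G v X + nonNbrs G X v
degree-split {n} G X v = trans (count-split X (adj G v) (allFin n))
                               (cong (_+ nonNbrs G X v) (count-cong (λ u → Bool.∧-comm (X u) (adj G v u)) (allFin n)))

complement-sizes : ∀ {n} (A : Subset n) → ∣ A ∣ₛ + ∣ ∁ A ∣ₛ ≡ n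
complement-sizes {n} A = begin
    ∣ A ∣ₛ + ∣ ∁ A ∣ₛ                                             ≡⟨ cong (∣ A ∣ₛ +_) (count-cong ∁≡not (allFin n)) ⟩
    count A (allFin n) + count (λ v → not (A v)) (allFin n)        ≡⟨ sym (count-split (λ _ → true) A (allFin n)) ⟩
    count (λ _ → true) (allFin n)                                  ≡⟨ count-true (allFin n) ⟩
    length (allFin n)                                              ≡⟨ length-tabulate (λ i → i) ⟩
    n                                                              ∎
  where
  open ≡-Reasoning
  ∁≡not : ∀ v → ∁ A v ≡ not (A v)
  ∁≡not v with A v
  ... | true  = refl
  ... | false = refl

∁-false : ∀ {n} (A : Subset n) {v} → A v ≡ false → ∁ A v ≡ true
∁-false A Av rewrite Av = refl

module DenseSidePaths {n} (G : Graph n) (X Y : Subset n) (DX : DenseSide G X) (DY : DenseSide G Y)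
  (sizes : ∣ X ∣ₛ + ∣ Y ∣ₛ ≡ n) (n≥21 : 21 ≤ n) (y₀ : Fin n) (Yy₀ : Y y₀ ≡ true) where

  open DenseSide

  -- Y has more vertices than exceptional ones, hence a good vertex g, so ∣ Y ∣ ≥ deg(g) ≳ n/2.
  large-Y : 499 * n ≤ 1000 * ∣ Y ∣ₛ
  large-Y = let g , Yg , ¬Eg = good-vertex in ≤-trans (good-deg DY g Yg ¬Eg) (*-monoʳ-≤ 1000 (deg≤size G Y g))
    where
    EY : Subset n
    EY = exceptional DY
    Good : Fin n → Bool
    Good u = Y u ∧ not (EY u)
    instance
      n≢0 : ℕ.NonZero n
      n≢0 = ℕ.>-nonZero (≤-trans (s≤s z≤n) n≥21)
    -- 1000 ∣ EY ∣ ≤ n < 249 n ≤ 1000 deg(y₀) ≤ 1000 ∣ Y ∣.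
    fewer : ∣ EY ∣ₛ < ∣ Y ∣ₛ
    fewer = *-cancelˡ-< 1000 _ _ (≤-<-trans (few-exceptional DY) (<-≤-trans (*-monoˡ-< n (≤ᵇ⇒≤ 2 249 _))
              (≤-trans (min-deg DY y₀ Yy₀) (*-monoʳ-≤ 1000 (deg≤size G Y y₀)))))
    Y≤ : ∣ Y ∣ₛ ≤ ∣ EY ∣ₛ + count Good (allFin n)
    Y≤ = ≤-trans (≤-reflexive (count-split Y EY (allFin n)))
                 (+-monoˡ-≤ _ (count-mono (λ u e → proj₂ (∧-true {Y u} e)) (allFin n)))
    some-good : 0 < count Good (allFin n)
    some-good = +-cancelˡ-< ∣ EY ∣ₛ 0 (count Good (allFin n))
                  (subst (_< ∣ EY ∣ₛ + count Good (allFin n)) (sym (+-identityʳ ∣ EY ∣ₛ)) (<-≤-trans fewer Y≤))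
    good-vertex : ∃ λ g → Y g ≡ true × EY g ≡ false
    good-vertex = let g , _ , Good-g , _ = pick Fin._≟_ Good [] (Unique.allFin⁺ n) some-good
                  in g , proj₁ (∧-true {Y g} Good-g) , not-true (proj₂ (∧-true {Y g} Good-g))

  few-non-nbrs : ∀ v → X v ≡ true → exceptional DX v ≡ false → nonNbrs G X v ≤ n / 500
  few-non-nbrs v Xv Ev = non-nbrs-bound {n} {nonNbrs G X v} {deg G v X} {∣ Y ∣ₛ}
                           (trans (cong (_+ ∣ Y ∣ₛ) (sym (degree-split G X v))) sizes) (good-deg DX v Xv Ev) large-Y

  high-deg : ∀ v → X v ≡ true → 4 * ∣ exceptional DX ∣ₛ + 3 * (n / 500) + 5 < deg G v X
  high-deg v Xv = high-deg-bound {n} {∣ exceptional DX ∣ₛ} {deg G v X} n≥21 (few-exceptional DX) (min-deg DX v Xv)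

  open HamiltonPathInDenseSet G X (exceptional DX) (n / 500) (exceptional⊆X DX) few-non-nbrs high-deg public
    using (module Between)

cycle-through : ∀ {m} (G : Graph (suc m)) (A : Subset (suc m)) {a₁ b₁ a₂ b₂} →
                SpanningPath G A a₂ a₁ → SpanningPath G (∁ A) b₁ b₂ → Edge G a₁ b₁ → Edge G a₂ b₂ →
                Σ (Permutation′ (suc m)) λ σ → IsHamCycle G σ × UsesEdge σ a₁ b₁ × UsesEdge σ a₂ b₂
cycle-through G A {a₁} {b₁} {a₂} {b₂} (qA , spansA) (qB , spansB) e₁ e₂ =
  σ , hamiltonian , uses-adjacent (adjacent-++ (a₂ ∷ tail qA) (ends qA)) , uses-closing
  where
  open XPath
  rest : List (Fin _)
  rest = tail qA ++ b₁ ∷ tail qB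
  linked-C : Linked (Edge G) (a₂ ∷ rest)
  linked-C = Linked.++⁺ (linked qA) (subst (λ l → Connected (Edge G) l (just b₁)) (sym (ends qA)) (just e₁)) (linked qB)
  unique-C : Unique (a₂ ∷ rest)
  unique-C = Unique.++⁺ (unique qA) (unique qB)
               λ (v∈A , v∈B) → in-A-and-∁A (All.lookup (inside qA) v∈A) (All.lookup (inside qB) v∈B)
    where
    in-A-and-∁A : ∀ {v} → A v ≡ true → ∁ A v ≡ true → ⊥
    in-A-and-∁A {v} Av ∁Av with A v
    in-A-and-∁A () _ | false
    in-A-and-∁A _ () | true
  complete : ∀ v → v ∈ a₂ ∷ rest
  complete v with A v in Av
  ... | true  = ∈-++⁺ˡ (spansA v Av)
  ... | false = ∈-++⁺ʳ (a₂ ∷ tail qA) (spansB v (∁-false A Av))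
  ends-C : last (a₂ ∷ rest) ≡ just b₂
  ends-C = trans (last-++ (a₂ ∷ tail qA) b₁ (tail qB)) (ends qB)
  open ListCycle G a₂ rest linked-C unique-C complete b₂ ends-C (trans (adj-sym G b₂ a₂) e₂)

-- The theorem for ε ≤ 1/1000 and n ≥ 21.
superextremal-cycle : ∀ {ε} → ε ℚ.≤ ε₀ → (n : ℕ) → n ≥ 21 → (G : Graph n) (A : Subset n) → SuperExtremal ε G A →
                      (a₁ b₁ a₂ b₂ : Fin n) → A a₁ ≡ true → A b₁ ≡ false → adj G a₁ b₁ ≡ true →
                      A a₂ ≡ true → A b₂ ≡ false → adj G a₂ b₂ ≡ true → a₁ ≢ a₂ → b₁ ≢ b₂ →
                      Σ (Permutation′ n) λ σ → IsHamCycle G σ × UsesEdge σ a₁ b₁ × UsesEdge σ a₂ b₂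
superextremal-cycle ε≤ε₀ (suc m) n≥21 G A (_ , A2 , A3 , A4 , A5) a₁ b₁ a₂ b₂ Aa₁ Ab₁ e₁ Aa₂ Ab₂ e₂ a₁≢a₂ b₁≢b₂ =
  cycle-through G A path-in-A path-in-B e₁ e₂
  where
  DA : DenseSide G A
  DA = dense-side ε≤ε₀ A2 A3
  DB : DenseSide G (∁ A)
  DB = dense-side ε≤ε₀ A4 A5
  path-in-A : SpanningPath G A a₂ a₁
  path-in-A = DenseSidePaths.Between.hamilton-path G A (∁ A) DA DB (complement-sizes A) n≥21 b₁ (∁-false A Ab₁)
                a₁ a₂ a₁≢a₂ Aa₁ Aa₂
  path-in-B : SpanningPath G (∁ A) b₁ b₂
  path-in-B = DenseSidePaths.Between.hamilton-path G (∁ A) A DB DA (trans (+-comm ∣ ∁ A ∣ₛ ∣ A ∣ₛ) (complement-sizes A))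
                n≥21 a₁ Aa₁ b₂ b₁ (λ b₂≡b₁ → b₁≢b₂ (sym b₂≡b₁)) (∁-false A Ab₂) (∁-false A Ab₁)

lemma17 : Σ ℚ λ ε₀ → 0ℚ ℚ.< ε₀ ×
            ((ε : ℚ) → 0ℚ ℚ.< ε → ε ℚ.≤ ε₀ →
              ∃ λ (n₀ : ℕ) → (n : ℕ) → n ≥ n₀ →
                (G : Graph n) (A : Subset n) → SuperExtremal ε G A →
                (a₁ b₁ a₂ b₂ : Fin n) →
                A a₁ ≡ true → A b₁ ≡ false → adj G a₁ b₁ ≡ true →
                A a₂ ≡ true → A b₂ ≡ false → adj G a₂ b₂ ≡ true →
                a₁ ≢ a₂ → b₁ ≢ b₂ →
                Σ (Permutation′ n) λ σ →
                  IsHamCycle G σ × UsesEdge σ a₁ b₁ × UsesEdge σ a₂ b₂)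
lemma17 = ε₀ , 0<ε₀ , λ ε _ ε≤ε₀ → 21 , superextremal-cycle ε≤ε₀
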